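{- Let $n\ge2$ and let $S=\{s_1<\cdots<s_{k_1}\}$, $T=\{t_1<\cdots<t_{k_2}\}$ be nonempty subsets of $\{1,\ldots,n-1\}$ with $\max S+\min T\le n$ and $\min S+\max T\le n$, and let $D$ be the digraph of $T_n\langle S;T\rangle$. Let $v$ be a vertex of $D$ and let $a_2,\ldots,a_{k_1},b_2,\ldots,b_{k_2}$ be nonnegative integers. Then: (a) There is a directed walk $W$ in $D$ starting from $v$, of length $\ell$, containing exactly $a_i$ $s_i$-arcs for each $2\le i\le k_1$ and exactly $b_j$ $t_j$-arcs for each $2\le j\le k_2$, where \[\ell\le(a_2+\cdots+a_{k_1}+b_2+\cdots+b_{k_2})\left(\max\left\{\left\lceil\frac{t_{k_2}}{s_1}\right\rceil,\left\lceil\frac{s_{k_1}}{t_1}\right\rceil\right\}+1\right).\] (b) Given such a walk $W$ as in (a), let $a_1$ and $b_1$ be the numbers of $s_1$-arcs and $t_1$-arcs in $W$. If integers $a\ge a_1$ and $b\ge b_1$ satisfy \[1\le v+as_1+\sum_{i=2}^{k_1}a_is_i-bt_1-\sum_{j=2}^{k_2}b_jt_j\le n,\] then there is a directed walk in $D$ starting from $v$ containing exactly $a$ $s_1$-arcs, exactly $b$ $t_1$-arcs, exactly $a_i$ $s_i$-arcs for each $2\le i\le k_1$ and exactly $b_j$ $t_j$-arcs for each $2\le j\le k_2$.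
   Context: $T_n\langle S;T\rangle$ is the $n\times n$ $(0,1)$-matrix whose $(i,j)$-entry is $1$ iff $j-i\in S$ or $i-j\in T$; its digraph $D$ has vertex set $[n]$ and an arc $(i,j)$ iff that entry is $1$. An arc $u\to w$ of $D$ is called an $s_i$-arc if $w-u=s_i$ and a $t_j$-arc if $u-w=t_j$. Arcs in a walk are counted with multiplicity. -}

module Defs where

open import Data.Nat using (ℕ; zero; suc; _+_; _*_; _∸_; _≤_; _<_; _≟_; _⊔_)
open import Data.Nat.DivMod using (_/_)
open import Data.Fin using (Fin; fromℕ) renaming (zero to fzero; suc to fsuc)
open import Data.List using (List; []; _∷_)
open import Data.Product using (Σ; _×_; ∃)
open import Data.Sum using (_⊎_)
open import Data.Unit using (⊤)
open import Relation.Nullary.Decidable using (⌊_⌋)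
open import Relation.Binary.PropositionalEquality using (_≡_)
open import Data.Bool using (if_then_else_)

-- S = {s 0 < ... < s k1-1}, T = {t 0 < ... < t k2-1}, given as functions on Fin.
-- Arc of the digraph D of T_n<S;T> : u → w iff u,w ∈ [n] and (w - u ∈ S or u - w ∈ T).
Arc : (n : ℕ) {k₁ k₂ : ℕ} → (Fin k₁ → ℕ) → (Fin k₂ → ℕ) → ℕ → ℕ → Set
Arc n {k₁} {k₂} s t u w =
  (1 ≤ u) × (u ≤ n) × (1 ≤ w) × (w ≤ n) ×
  ((Σ (Fin k₁) λ i → w ≡ u + s i) ⊎ (Σ (Fin k₂) λ j → u ≡ w + t j))

-- A directed walk starting at u is given by the list of subsequent vertices;
-- IsWalk u ws holds iff consecutive vertices of u ∷ ws are arcs of D.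
-- (The start vertex u is assumed to be a vertex of D separately.)
IsWalk : (n : ℕ) {k₁ k₂ : ℕ} → (Fin k₁ → ℕ) → (Fin k₂ → ℕ) → ℕ → List ℕ → Set
IsWalk n s t u [] = ⊤
IsWalk n s t u (w ∷ ws) = Arc n s t u w × IsWalk n s t w ws

countS : ℕ → ℕ → List ℕ → ℕ
countS c u [] = 0
countS c u (w ∷ ws) = (if ⌊ w ≟ u + c ⌋ then 1 else 0) + countS c w ws

countT : ℕ → ℕ → List ℕ → ℕ
countT c u [] = 0
countT c u (w ∷ ws) = (if ⌊ u ≟ w + c ⌋ then 1 else 0) + countT c w ws

sumFin : {p : ℕ} → (Fin p → ℕ) → ℕ
sumFin {zero} f = 0
sumFin {suc p} f = f fzero + sumFin (λ i → f (fsuc i))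

-- ceiling division ⌈ m / d ⌉ (only used with d ≥ 1; value 0 for d = 0)
ceilDiv : ℕ → ℕ → ℕ
ceilDiv m zero = 0
ceilDiv m (suc d) = (m + d) / suc d

-- Indices are shifted by one: s fzero and t fzero are the paper's s₁ and t₁.
--
-- (a) An s_i-arc (i ≥ 2) is produced by first following t₁-arcs downwards until
-- an s_i-arc fits below n; this takes at most ⌈sₘₐₓ/t₁⌉ steps and cannot drop
-- below 1, because a vertex too high for s_i exceeds n - sₘₐₓ ≥ t₁.
-- Symmetrically a t_j-arc is preceded by at most ⌈tₘₐₓ/s₁⌉ s₁-arcs, using
-- s₁ + tₘₐₓ ≤ n. As s₁ < s_i and t₁ < t_j, the auxiliary arcs count as neither.
--
-- (b) The end vertex of a walk from v is v plus the total length of its s-arcs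
-- minus that of its t-arcs. So the hypothesis says exactly that the vertex u
-- reached from the end of W by a - a₁ further s₁-arcs and b - b₁ further t₁-arcs
-- lies in [n]. These arcs are appended greedily; since s₁ + t₁ ≤ n, whenever an
-- s₁-arc does not fit a t₁-arc does.

module Submission where

open import Defs
open import Data.Nat using (ℕ; zero; suc; pred; _+_; _*_; _∸_; _≤_; _<_; _⊔_; z≤n; s≤s; s≤s⁻¹; z<s; _≤?_; _<?_; _≟_)
open import Data.Nat.Properties
open import Data.Nat.DivMod using (_/_; _%_; m≡m%n+[m/n]*n; m%n<n)
open import Data.Nat.Tactic.RingSolver using (solve)
open import Algebra.Properties.CommutativeSemigroup +-commutativeSemigroup using (interchange; xy∙z≈y∙xz; xy∙z≈xz∙y; x∙yz≈y∙xz; x∙yz≈yx∙z)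
open import Data.Fin using (Fin; fromℕ) renaming (zero to fzero; suc to fsuc; _<_ to _<ᶠ_)
open import Data.Fin.Properties using (≤fromℕ) renaming (<-cmp to <ᶠ-cmp; _≟_ to _≟ᶠ_; suc-injective to fsuc-injective)
open import Data.Vec.Functional using (updateAt)
open import Data.Vec.Functional.Properties using (updateAt-updates; updateAt-minimal)
open import Data.List using (List; []; _∷_; _++_; length)
open import Data.List.Properties using (length-++)
open import Data.Product using (Σ; _×_; _,_; proj₁; proj₂; uncurry)
open import Data.Sum using (_⊎_; inj₁; inj₂)
open import Data.Unit using (tt)
open import Data.Empty using (⊥-elim)
open import Data.Bool using (if_then_else_)
import Data.Integer as ℤ
import Data.Integer.Properties as ℤₚ
open import Function using (_∘_)
open import Relation.Nullary using (¬_; yes; no)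
open import Relation.Nullary.Decidable using (⌊_⌋)
open import Relation.Unary using (Pred; Decidable)
open import Relation.Binary using (tri<; tri≈; tri>)
open import Relation.Binary.PropositionalEquality using (_≡_; _≢_; refl; sym; trans; cong; cong₂; subst; subst₂; module ≡-Reasoning)

m<m+n+o : ∀ m {n} o → 0 < n → m < m + n + o
m<m+n+o m o 0<n = <-≤-trans (m<m+n m 0<n) (m≤m+n _ o)

split-above : ∀ {d x} → d < x → Σ ℕ λ y → 1 ≤ y × y + d ≡ x
split-above {d} {x} d<x = x ∸ d , m<n⇒0<n∸m d<x , m∸n+n≡m (<⇒≤ d<x)

overflow⇒< : ∀ {d c n x} → d + c ≤ n → n < x + c → d < x
overflow⇒< {d} {c} d+c≤n n<x+c = +-cancelʳ-< c d _ (≤-<-trans d+c≤n n<x+c)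

≤-shift : ∀ {x c d n} → x ≤ c → d + c ≤ n → x + d ≤ n
≤-shift {x} {c} {d} x≤c d+c≤n = ≤-trans (subst (x + d ≤_) (+-comm c d) (+-monoˡ-≤ d x≤c)) d+c≤n

cancel-middle-≤ : ∀ a b c d e → a + b + c ≤ d + (b + e) → a + c ≤ d + e
cancel-middle-≤ a b c d e le =
  +-cancelˡ-≤ b _ _ (subst₂ _≤_ (xy∙z≈y∙xz a b c) (x∙yz≈y∙xz d b e) le)

cancel-middle-≡ : ∀ a b c d e → a + b + c ≡ d + (b + e) → a + c ≡ d + e
cancel-middle-≡ a b c d e eq =
  +-cancelˡ-≡ b _ _ (trans (sym (xy∙z≈y∙xz a b c)) (trans eq (x∙yz≈y∙xz d b e)))

ceilDiv-spec : ∀ m d → 1 ≤ d → m ≤ ceilDiv m d * d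
ceilDiv-spec m (suc d) _ = +-cancelˡ-≤ d m _ (begin
  d + m                                    ≡⟨ +-comm d m ⟩
  m + d                                    ≡⟨ m≡m%n+[m/n]*n (m + d) (suc d) ⟩
  (m + d) % suc d + (m + d) / suc d * suc d ≤⟨ +-monoˡ-≤ _ (s≤s⁻¹ (m%n<n (m + d) (suc d))) ⟩
  d + (m + d) / suc d * suc d              ∎)
  where open ≤-Reasoning

inRange-difference : ∀ P Q n → ℤ.+ 1 ℤ.≤ ℤ.+ P ℤ.- ℤ.+ Q → ℤ.+ P ℤ.- ℤ.+ Q ℤ.≤ ℤ.+ n →
                     Σ ℕ λ z → 1 ≤ z × z ≤ n × z + Q ≡ P
inRange-difference P Q n low high rewrite ℤₚ.[+m]-[+n]≡m⊖n P Q with Q ≤? P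
... | yes Q≤P rewrite ℤₚ.⊖-≥ Q≤P = P ∸ Q , ℤₚ.drop‿+≤+ low , ℤₚ.drop‿+≤+ high , m∸n+n≡m Q≤P
... | no Q≰P rewrite ℤₚ.⊖-< (≰⇒> Q≰P) =
  ⊥-elim (<-irrefl refl (ℤₚ.drop‿+≤+ (ℤₚ.≤-trans low (ℤₚ.neg-≤-pos {Q ∸ P} {0}))))

residual-balance : ∀ e z v a₁ α b₁ β s₀ t₀ A B →
                   e + (b₁ * t₀ + B) ≡ v + (a₁ * s₀ + A) →
                   z + ((b₁ + β) * t₀ + B) ≡ v + (a₁ + α) * s₀ + A →
                   e + α * s₀ ≡ z + β * t₀
residual-balance e z v a₁ α b₁ β s₀ t₀ A B balance target =
  +-cancelʳ-≡ (b₁ * t₀ + B) _ _ (begin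
    e + α * s₀ + (b₁ * t₀ + B)   ≡⟨ xy∙z≈xz∙y e (α * s₀) _ ⟩
    e + (b₁ * t₀ + B) + α * s₀   ≡⟨ cong (_+ α * s₀) balance ⟩
    v + (a₁ * s₀ + A) + α * s₀   ≡⟨ solve (v ∷ a₁ ∷ α ∷ s₀ ∷ A ∷ []) ⟩
    v + (a₁ + α) * s₀ + A        ≡⟨ target ⟨
    z + ((b₁ + β) * t₀ + B)      ≡⟨ solve (z ∷ b₁ ∷ β ∷ t₀ ∷ B ∷ []) ⟩
    z + β * t₀ + (b₁ * t₀ + B)   ∎)
  where open ≡-Reasoning

-- Finite sums

sumFin-cong : ∀ {m} {f g : Fin m → ℕ} → (∀ i → f i ≡ g i) → sumFin f ≡ sumFin g
sumFin-cong {zero}  _   = refl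
sumFin-cong {suc m} f≗g = cong₂ _+_ (f≗g fzero) (sumFin-cong (f≗g ∘ fsuc))

sumFin-+ : ∀ {m} (f g : Fin m → ℕ) → sumFin (λ i → f i + g i) ≡ sumFin f + sumFin g
sumFin-+ {zero}  f g = refl
sumFin-+ {suc m} f g = trans (cong ((f fzero + g fzero) +_) (sumFin-+ (f ∘ fsuc) (g ∘ fsuc)))
                             (interchange (f fzero) (g fzero) _ _)

sumFin-*-distribʳ-+ : ∀ {m} (c a b : Fin m → ℕ) →
                     sumFin (λ i → (a i + b i) * c i) ≡ sumFin (λ i → a i * c i) + sumFin (λ i → b i * c i)
sumFin-*-distribʳ-+ c a b =
  trans (sumFin-cong λ i → *-distribʳ-+ (c i) (a i) (b i)) (sumFin-+ (λ i → a i * c i) (λ i → b i * c i))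

sumFin-zero : ∀ {m} {f : Fin m → ℕ} → (∀ i → f i ≡ 0) → sumFin f ≡ 0
sumFin-zero {zero}  _   = refl
sumFin-zero {suc m} f≡0 = cong₂ _+_ (f≡0 fzero) (sumFin-zero (f≡0 ∘ fsuc))

sumFin≡0⇒≡0 : ∀ {m} (f : Fin m → ℕ) → sumFin f ≡ 0 → ∀ i → f i ≡ 0
sumFin≡0⇒≡0 f sum≡0 fzero    = m+n≡0⇒m≡0 (f fzero) sum≡0
sumFin≡0⇒≡0 f sum≡0 (fsuc i) = sumFin≡0⇒≡0 (f ∘ fsuc) (m+n≡0⇒n≡0 (f fzero) sum≡0) i

sumFin-single : ∀ {m} (f : Fin m → ℕ) i → (∀ i′ → i′ ≢ i → f i′ ≡ 0) → sumFin f ≡ f i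
sumFin-single f fzero    off = trans (cong (f fzero +_) (sumFin-zero (λ i′ → off (fsuc i′) λ ())))
                                     (+-identityʳ (f fzero))
sumFin-single f (fsuc i) off =
  cong₂ _+_ (off fzero λ ()) (sumFin-single (f ∘ fsuc) i λ i′ i′≢i → off (fsuc i′) (i′≢i ∘ fsuc-injective))

module _ {m ℓ} {P : Pred (Fin m) ℓ} (P? : Decidable P) (f : Fin m → ℕ) where

  sumFin-indicator : ∀ {i₀} → P i₀ → (∀ {i} → P i → i ≡ i₀) →
                     sumFin (λ i → (if ⌊ P? i ⌋ then 1 else 0) * f i) ≡ f i₀
  sumFin-indicator {i₀} p₀ unique = trans (sumFin-single _ i₀ off) on
    where
    off : ∀ i → i ≢ i₀ → (if ⌊ P? i ⌋ then 1 else 0) * f i ≡ 0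
    off i i≢i₀ with P? i
    ... | yes p = ⊥-elim (i≢i₀ (unique p))
    ... | no _  = refl
    on : (if ⌊ P? i₀ ⌋ then 1 else 0) * f i₀ ≡ f i₀
    on with P? i₀
    ... | yes _  = +-identityʳ (f i₀)
    ... | no ¬p₀ = ⊥-elim (¬p₀ p₀)

  sumFin-indicator-∅ : (∀ i → ¬ P i) → sumFin (λ i → (if ⌊ P? i ⌋ then 1 else 0) * f i) ≡ 0
  sumFin-indicator-∅ none = sumFin-zero off
    where
    off : ∀ i → (if ⌊ P? i ⌋ then 1 else 0) * f i ≡ 0
    off i with P? i
    ... | yes p = ⊥-elim (none i p)
    ... | no _  = refl

positiveEntry⊎allZero : ∀ {m} (f : Fin m → ℕ) →
                        (Σ (Fin m) λ i → Σ ℕ λ k → f i ≡ suc k) ⊎ (∀ i → f i ≡ 0)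
positiveEntry⊎allZero {zero}  f = inj₂ λ ()
positiveEntry⊎allZero {suc m} f with f fzero in f₀ | positiveEntry⊎allZero (f ∘ fsuc)
... | suc k | _                   = inj₁ (fzero , k , f₀)
... | zero  | inj₁ (i , k , fᵢ)   = inj₁ (fsuc i , k , fᵢ)
... | zero  | inj₂ rest≡0        = inj₂ λ { fzero → f₀ ; (fsuc i) → rest≡0 i }

indicator : ∀ {m} → Fin m → Fin m → ℕ
indicator i i′ = if ⌊ i′ ≟ᶠ i ⌋ then 1 else 0

indicator+updateAt-pred : ∀ {m} (f : Fin m → ℕ) {i k} → f i ≡ suc k →
                          ∀ i′ → indicator i i′ + updateAt f i pred i′ ≡ f i′
indicator+updateAt-pred f {i} fᵢ i′ with i′ ≟ᶠ i
... | yes refl = trans (cong suc (updateAt-updates i f)) (trans (cong (suc ∘ pred) fᵢ) (sym fᵢ))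
... | no i′≢i  = updateAt-minimal i′ i f i′≢i

sumFin-updateAt-pred : ∀ {m} (f : Fin m → ℕ) i {k} → f i ≡ suc k →
                       sumFin f ≡ suc (sumFin (updateAt f i pred))
sumFin-updateAt-pred f fzero    fᵢ rewrite fᵢ = refl
sumFin-updateAt-pred f (fsuc i) fᵢ =
  trans (cong (f fzero +_) (sumFin-updateAt-pred (f ∘ fsuc) i fᵢ)) (+-suc (f fzero) _)

module _ {m} {f : Fin m → ℕ} (increasing : ∀ i i′ → i <ᶠ i′ → f i < f i′) where

  increasing⇒injective : ∀ {i i′} → f i ≡ f i′ → i ≡ i′
  increasing⇒injective {i} {i′} fᵢ≡fᵢ′ with <ᶠ-cmp i i′
  ... | tri< i<i′ _ _    = ⊥-elim (<⇒≢ (increasing _ _ i<i′) fᵢ≡fᵢ′)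
  ... | tri≈ _ i≡i′ _    = i≡i′
  ... | tri> _ _ i′<i    = ⊥-elim (>⇒≢ (increasing _ _ i′<i) fᵢ≡fᵢ′)

increasing⇒≤last : ∀ {p} {f : Fin (suc p) → ℕ} → (∀ i i′ → i <ᶠ i′ → f i < f i′) →
                   ∀ i → f i ≤ f (fromℕ p)
increasing⇒≤last {p} increasing i with <ᶠ-cmp i (fromℕ p)
... | tri< i<last _ _ = <⇒≤ (increasing _ _ i<last)
... | tri≈ _ refl _   = ≤-refl
... | tri> _ _ last<i = ⊥-elim (<⇒≱ last<i (≤fromℕ i))

-- Walks

endVertex : ℕ → List ℕ → ℕ
endVertex u []       = u
endVertex u (w ∷ ws) = endVertex w ws

countS-++ : ∀ c u W X → countS c u (W ++ X) ≡ countS c u W + countS c (endVertex u W) X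
countS-++ c u []      X = refl
countS-++ c u (w ∷ W) X =
  trans (cong ((if ⌊ w ≟ u + c ⌋ then 1 else 0) +_) (countS-++ c w W X))
        (sym (+-assoc (if ⌊ w ≟ u + c ⌋ then 1 else 0) _ _))

countT-++ : ∀ c u W X → countT c u (W ++ X) ≡ countT c u W + countT c (endVertex u W) X
countT-++ c u []      X = refl
countT-++ c u (w ∷ W) X =
  trans (cong ((if ⌊ u ≟ w + c ⌋ then 1 else 0) +_) (countT-++ c w W X))
        (sym (+-assoc (if ⌊ u ≟ w + c ⌋ then 1 else 0) _ _))

countS-hit : ∀ {c u w} ws → w ≡ u + c → countS c u (w ∷ ws) ≡ suc (countS c w ws)
countS-hit {c} {u} {w} ws hit with w ≟ u + c
... | yes _   = refl
... | no miss = ⊥-elim (miss hit)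

countS-miss : ∀ {c u w} ws → w ≢ u + c → countS c u (w ∷ ws) ≡ countS c w ws
countS-miss {c} {u} {w} ws miss with w ≟ u + c
... | yes hit = ⊥-elim (miss hit)
... | no _    = refl

countT-hit : ∀ {c u w} ws → u ≡ w + c → countT c u (w ∷ ws) ≡ suc (countT c w ws)
countT-hit {c} {u} {w} ws hit with u ≟ w + c
... | yes _   = refl
... | no miss = ⊥-elim (miss hit)

countT-miss : ∀ {c u w} ws → u ≢ w + c → countT c u (w ∷ ws) ≡ countT c w ws
countT-miss {c} {u} {w} ws miss with u ≟ w + c
... | yes hit = ⊥-elim (miss hit)
... | no _    = refl

countS-descending : ∀ c {d} y ws → 0 < d → countS c (y + d) (y ∷ ws) ≡ countS c y ws
countS-descending c y ws 0<d = countS-miss ws (<⇒≢ (m<m+n+o y c 0<d))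

countT-ascending : ∀ c {d} x ws → 0 < d → countT c x (x + d ∷ ws) ≡ countT c (x + d) ws
countT-ascending c x ws 0<d = countT-miss ws (<⇒≢ (m<m+n+o x c 0<d))

countS-other : ∀ {c d} x ws → c ≢ d → countS c x (x + d ∷ ws) ≡ countS c (x + d) ws
countS-other x ws c≢d = countS-miss ws (c≢d ∘ sym ∘ +-cancelˡ-≡ x _ _)

countT-other : ∀ {c d} y ws → c ≢ d → countT c (y + d) (y ∷ ws) ≡ countT c y ws
countT-other y ws c≢d = countT-miss ws (c≢d ∘ sym ∘ +-cancelˡ-≡ y _ _)

module Walks (n : ℕ) {k₁ k₂ : ℕ} (s : Fin k₁ → ℕ) (t : Fin k₂ → ℕ) where

  s-arc : ∀ {x} i → 1 ≤ x → x + s i ≤ n → Arc n s t x (x + s i)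
  s-arc {x} i 1≤x fits = 1≤x , ≤-trans (m≤m+n x _) fits , ≤-trans 1≤x (m≤m+n x _) , fits , inj₁ (i , refl)

  t-arc : ∀ {y} j → 1 ≤ y → y + t j ≤ n → Arc n s t (y + t j) y
  t-arc {y} j 1≤y fits = ≤-trans 1≤y (m≤m+n y _) , fits , 1≤y , ≤-trans (m≤m+n y _) fits , inj₂ (j , refl)

  IsWalk-++ : ∀ {u} W {X} → IsWalk n s t u W → IsWalk n s t (endVertex u W) X → IsWalk n s t u (W ++ X)
  IsWalk-++ []      _                 X-walk = X-walk
  IsWalk-++ (w ∷ W) (arc , W-walk) X-walk = arc , IsWalk-++ W W-walk X-walk

  endVertex-bounds : ∀ {u} W → 1 ≤ u → u ≤ n → IsWalk n s t u W → 1 ≤ endVertex u W × endVertex u W ≤ n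
  endVertex-bounds []      1≤u u≤n _                               = 1≤u , u≤n
  endVertex-bounds (w ∷ W) _   _   ((_ , _ , 1≤w , w≤n , _) , W-walk) = endVertex-bounds W 1≤w w≤n W-walk

-- By injectivity and positivity, each arc contributes its length to exactly one
-- of ascent and descent.
module Displacement {k₁ k₂ : ℕ} (s : Fin k₁ → ℕ) (t : Fin k₂ → ℕ)
  (s-injective : ∀ {i i′} → s i ≡ s i′ → i ≡ i′) (t-injective : ∀ {j j′} → t j ≡ t j′ → j ≡ j′)
  (s-positive : ∀ i → 0 < s i) where

  ascent : ℕ → List ℕ → ℕ
  ascent u W = sumFin (λ i → countS (s i) u W * s i)

  descent : ℕ → List ℕ → ℕ
  descent u W = sumFin (λ j → countT (t j) u W * t j)

  ascent-∷ : ∀ u w ws →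
             ascent u (w ∷ ws) ≡ sumFin (λ i → (if ⌊ w ≟ u + s i ⌋ then 1 else 0) * s i) + ascent w ws
  ascent-∷ u w ws = sumFin-*-distribʳ-+ s (λ i → if ⌊ w ≟ u + s i ⌋ then 1 else 0) (λ i → countS (s i) w ws)

  descent-∷ : ∀ u w ws →
              descent u (w ∷ ws) ≡ sumFin (λ j → (if ⌊ u ≟ w + t j ⌋ then 1 else 0) * t j) + descent w ws
  descent-∷ u w ws = sumFin-*-distribʳ-+ t (λ j → if ⌊ u ≟ w + t j ⌋ then 1 else 0) (λ j → countT (t j) w ws)

  ascent-s-arc : ∀ u i ws → ascent u (u + s i ∷ ws) ≡ s i + ascent (u + s i) ws
  ascent-s-arc u i ws = trans (ascent-∷ u (u + s i) ws) (cong (_+ ascent (u + s i) ws)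
    (sumFin-indicator (λ i′ → u + s i ≟ u + s i′) s refl (sym ∘ s-injective ∘ +-cancelˡ-≡ u _ _)))

  descent-s-arc : ∀ u i ws → descent u (u + s i ∷ ws) ≡ descent (u + s i) ws
  descent-s-arc u i ws = trans (descent-∷ u (u + s i) ws) (cong (_+ descent (u + s i) ws)
    (sumFin-indicator-∅ (λ j → u ≟ u + s i + t j) t λ j → <⇒≢ (m<m+n+o u (t j) (s-positive i))))

  ascent-t-arc : ∀ w j ws → ascent (w + t j) (w ∷ ws) ≡ ascent w ws
  ascent-t-arc w j ws = trans (ascent-∷ (w + t j) w ws) (cong (_+ ascent w ws)
    (sumFin-indicator-∅ (λ i → w ≟ w + t j + s i) s
      λ i → <⇒≢ (≤-<-trans (m≤m+n w (t j)) (m<m+n (w + t j) (s-positive i)))))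

  descent-t-arc : ∀ w j ws → descent (w + t j) (w ∷ ws) ≡ t j + descent w ws
  descent-t-arc w j ws = trans (descent-∷ (w + t j) w ws) (cong (_+ descent w ws)
    (sumFin-indicator (λ j′ → w + t j ≟ w + t j′) t refl (sym ∘ t-injective ∘ +-cancelˡ-≡ w _ _)))

  endVertex-balance : ∀ {n} u W → IsWalk n s t u W → endVertex u W + descent u W ≡ u + ascent u W
  endVertex-balance u [] _ =
    cong (u +_) (trans (sumFin-zero {f = λ j → countT (t j) u [] * t j} λ _ → refl)
                      (sym (sumFin-zero {f = λ i → countS (s i) u [] * s i} λ _ → refl)))
  endVertex-balance u (_ ∷ ws) ((_ , _ , _ , _ , inj₁ (i , refl)) , walk) = begin
    endVertex (u + s i) ws + descent u (u + s i ∷ ws) ≡⟨ cong (endVertex (u + s i) ws +_) (descent-s-arc u i ws) ⟩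
    endVertex (u + s i) ws + descent (u + s i) ws     ≡⟨ endVertex-balance (u + s i) ws walk ⟩
    u + s i + ascent (u + s i) ws                     ≡⟨ +-assoc u (s i) _ ⟩
    u + (s i + ascent (u + s i) ws)                   ≡⟨ cong (u +_) (ascent-s-arc u i ws) ⟨
    u + ascent u (u + s i ∷ ws)                       ∎
    where open ≡-Reasoning
  endVertex-balance _ (w ∷ ws) ((_ , _ , _ , _ , inj₂ (j , refl)) , walk) = begin
    endVertex w ws + descent (w + t j) (w ∷ ws) ≡⟨ cong (endVertex w ws +_) (descent-t-arc w j ws) ⟩
    endVertex w ws + (t j + descent w ws)       ≡⟨ x∙yz≈y∙xz (endVertex w ws) (t j) _ ⟩
    t j + (endVertex w ws + descent w ws)       ≡⟨ cong (t j +_) (endVertex-balance w ws walk) ⟩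
    t j + (w + ascent w ws)                     ≡⟨ x∙yz≈yx∙z (t j) w _ ⟩
    w + t j + ascent w ws                       ≡⟨ cong (w + t j +_) (ascent-t-arc w j ws) ⟨
    w + t j + ascent (w + t j) (w ∷ ws)         ∎
    where open ≡-Reasoning

-- Walks with prescribed arc counts

module Construction (n p q : ℕ) (s : Fin (suc p) → ℕ) (t : Fin (suc q) → ℕ)
  (s-positive : ∀ i → 0 < s i) (t-positive : ∀ j → 0 < t j)
  (s-increasing : ∀ i i′ → i <ᶠ i′ → s i < s i′) (t-increasing : ∀ j j′ → j <ᶠ j′ → t j < t j′)
  (sₘₐₓ+t₀≤n : s (fromℕ p) + t fzero ≤ n) (s₀+tₘₐₓ≤n : s fzero + t (fromℕ q) ≤ n) where

  s-injective : ∀ {i i′} → s i ≡ s i′ → i ≡ i′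
  s-injective = increasing⇒injective s-increasing

  t-injective : ∀ {j j′} → t j ≡ t j′ → j ≡ j′
  t-injective = increasing⇒injective t-increasing

  open Walks n s t
  open Displacement s t s-injective t-injective s-positive

  s₀ t₀ sₘₐₓ tₘₐₓ M : ℕ
  s₀   = s fzero
  t₀   = t fzero
  sₘₐₓ = s (fromℕ p)
  tₘₐₓ = t (fromℕ q)
  M    = ceilDiv tₘₐₓ s₀ ⊔ ceilDiv sₘₐₓ t₀

  t₀+s₀≤n : t₀ + s₀ ≤ n
  t₀+s₀≤n = begin
    t₀ + s₀   ≡⟨ +-comm t₀ s₀ ⟩
    s₀ + t₀   ≤⟨ +-monoʳ-≤ s₀ (increasing⇒≤last t-increasing fzero) ⟩
    s₀ + tₘₐₓ ≤⟨ s₀+tₘₐₓ≤n ⟩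
    n         ∎
    where open ≤-Reasoning

  Neutral : ℕ → List ℕ → Set
  Neutral x W = (∀ i → countS (s (fsuc i)) x W ≡ 0) × (∀ j → countT (t (fsuc j)) x W ≡ 0)

  neutral-[] : ∀ x → Neutral x []
  neutral-[] _ = (λ _ → refl) , (λ _ → refl)

  neutral-up : ∀ x W → Neutral (x + s₀) W → Neutral x (x + s₀ ∷ W)
  neutral-up x W (W-s , W-t) =
    (λ i → trans (countS-other x W (>⇒≢ (s-increasing fzero (fsuc i) z<s))) (W-s i)) ,
    (λ j → trans (countT-ascending (t (fsuc j)) x W (s-positive fzero)) (W-t j))

  neutral-down : ∀ y W → Neutral y W → Neutral (y + t₀) (y ∷ W)
  neutral-down y W (W-s , W-t) =
    (λ i → trans (countS-descending (s (fsuc i)) y W (t-positive fzero)) (W-s i)) ,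
    (λ j → trans (countT-other y W (>⇒≢ (t-increasing fzero (fsuc j) z<s))) (W-t j))

  descend : ∀ c → t₀ + c ≤ n → ∀ k {x} → 1 ≤ x → x ≤ n → x + c ≤ n + k * t₀ →
            Σ (List ℕ) λ W → IsWalk n s t x W × Neutral x W × length W ≤ k × endVertex x W + c ≤ n
  descend c t₀+c≤n k {x} 1≤x x≤n x+c≤ with x + c ≤? n
  ... | yes fits = [] , tt , neutral-[] x , z≤n , fits
  descend c t₀+c≤n zero {x} 1≤x x≤n x+c≤ | no ¬fits =
    ⊥-elim (¬fits (subst (x + c ≤_) (+-identityʳ n) x+c≤))
  descend c t₀+c≤n (suc k) {x} 1≤x x≤n x+c≤ | no ¬fits
    with split-above {t₀} {x} (overflow⇒< t₀+c≤n (≰⇒> ¬fits))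
  ... | y , 1≤y , refl
    with descend c t₀+c≤n k 1≤y (≤-trans (m≤m+n y t₀) x≤n) (cancel-middle-≤ y t₀ c n (k * t₀) x+c≤)
  ...   | W , W-walk , W-neutral , W-len , fits =
    y ∷ W , (t-arc fzero 1≤y x≤n , W-walk) , neutral-down y W W-neutral , s≤s W-len , fits

  ascend : ∀ c → s₀ + c ≤ n → ∀ k {x} → 1 ≤ x → x ≤ n → c < x + k * s₀ →
           Σ (List ℕ) λ W → IsWalk n s t x W × Neutral x W × length W ≤ k × c < endVertex x W
  ascend c s₀+c≤n k {x} 1≤x x≤n c< with c <? x
  ... | yes c<x = [] , tt , neutral-[] x , z≤n , c<x
  ascend c s₀+c≤n zero {x} 1≤x x≤n c< | no c≮x = ⊥-elim (c≮x (subst (c <_) (+-identityʳ x) c<))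
  ascend c s₀+c≤n (suc k) {x} 1≤x x≤n c< | no c≮x with fits ← ≤-shift (≮⇒≥ c≮x) s₀+c≤n
    with ascend c s₀+c≤n k (≤-trans 1≤x (m≤m+n x s₀)) fits (subst (c <_) (sym (+-assoc x s₀ (k * s₀))) c<)
  ... | W , W-walk , W-neutral , W-len , c<end =
    x + s₀ ∷ W , (s-arc fzero 1≤x fits , W-walk) , neutral-up x W W-neutral , s≤s W-len , c<end

  Realises : ℕ → (Fin p → ℕ) → (Fin q → ℕ) → ℕ → Set
  Realises x f g L = Σ (List ℕ) λ W → IsWalk n s t x W ×
                     (∀ i → countS (s (fsuc i)) x W ≡ f i) × (∀ j → countT (t (fsuc j)) x W ≡ g j) ×
                     length W ≤ L

  realises-++ : ∀ {x f₁ g₁ L₁ f₂ g₂ L₂} (r : Realises x f₁ g₁ L₁) →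
                Realises (endVertex x (proj₁ r)) f₂ g₂ L₂ →
                Realises x (λ i → f₁ i + f₂ i) (λ j → g₁ j + g₂ j) (L₁ + L₂)
  realises-++ {x} (W , W-walk , W-s , W-t , W-len) (X , X-walk , X-s , X-t , X-len) =
    W ++ X , IsWalk-++ W W-walk X-walk ,
    (λ i → trans (countS-++ _ x W X) (cong₂ _+_ (W-s i) (X-s i))) ,
    (λ j → trans (countT-++ _ x W X) (cong₂ _+_ (W-t j) (X-t j))) ,
    subst (_≤ _) (sym (length-++ W)) (+-mono-≤ W-len X-len)

  realises-then : ∀ {x f₁ g₁ L₁ f₂ g₂ L₂} → 1 ≤ x → x ≤ n → Realises x f₁ g₁ L₁ →
                  (∀ {y} → 1 ≤ y → y ≤ n → Realises y f₂ g₂ L₂) →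
                  Realises x (λ i → f₁ i + f₂ i) (λ j → g₁ j + g₂ j) (L₁ + L₂)
  realises-then 1≤x x≤n r@(W , W-walk , _) next =
    realises-++ r (uncurry next (endVertex-bounds W 1≤x x≤n W-walk))

  realises-cong : ∀ {x f g f′ g′ L L′} → (∀ i → f i ≡ f′ i) → (∀ j → g j ≡ g′ j) → L ≤ L′ →
                  Realises x f g L → Realises x f′ g′ L′
  realises-cong f≗f′ g≗g′ L≤L′ (W , W-walk , W-s , W-t , W-len) =
    W , W-walk , (λ i → trans (W-s i) (f≗f′ i)) , (λ j → trans (W-t j) (g≗g′ j)) , ≤-trans W-len L≤L′

  s-step : ∀ i {e} → 1 ≤ e → e + s (fsuc i) ≤ n → Realises e (indicator i) (λ _ → 0) 1
  s-step i {e} 1≤e fits =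
    e + s (fsuc i) ∷ [] , (s-arc (fsuc i) 1≤e fits , tt) , counted ,
    (λ j → countT-ascending (t (fsuc j)) e [] (s-positive (fsuc i))) , s≤s z≤n
    where
    counted : ∀ i′ → countS (s (fsuc i′)) e (e + s (fsuc i) ∷ []) ≡ indicator i i′
    counted i′ with i′ ≟ᶠ i
    ... | yes refl = countS-hit {u = e} [] refl
    ... | no i′≢i  = countS-other e [] (i′≢i ∘ fsuc-injective ∘ s-injective)

  t-step : ∀ j {e} → t (fsuc j) < e → e ≤ n → Realises e (λ _ → 0) (indicator j) 1
  t-step j t<e e≤n with split-above t<e
  ... | y , 1≤y , refl =
    y ∷ [] , (t-arc (fsuc j) 1≤y e≤n , tt) ,
    (λ i → countS-descending (s (fsuc i)) y [] (t-positive (fsuc j))) , counted , s≤s z≤n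
    where
    counted : ∀ j′ → countT (t (fsuc j′)) (y + t (fsuc j)) (y ∷ []) ≡ indicator j j′
    counted j′ with j′ ≟ᶠ j
    ... | yes refl = countT-hit {w = y} [] refl
    ... | no j′≢j  = countT-other y [] (j′≢j ∘ fsuc-injective ∘ t-injective)

  s-task : ∀ i {x} → 1 ≤ x → x ≤ n → Realises x (indicator i) (λ _ → 0) (M + 1)
  s-task i {x} 1≤x x≤n with descend (s (fsuc i)) t₀+sᵢ≤n K 1≤x x≤n (+-mono-≤ x≤n sᵢ≤K*t₀)
    where
    K : ℕ
    K = ceilDiv sₘₐₓ t₀
    sᵢ≤sₘₐₓ : s (fsuc i) ≤ sₘₐₓ
    sᵢ≤sₘₐₓ = increasing⇒≤last s-increasing (fsuc i)
    t₀+sᵢ≤n : t₀ + s (fsuc i) ≤ n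
    t₀+sᵢ≤n = ≤-trans (≤-reflexive (+-comm t₀ _)) (≤-trans (+-monoˡ-≤ t₀ sᵢ≤sₘₐₓ) sₘₐₓ+t₀≤n)
    sᵢ≤K*t₀ : s (fsuc i) ≤ K * t₀
    sᵢ≤K*t₀ = ≤-trans sᵢ≤sₘₐₓ (ceilDiv-spec sₘₐₓ t₀ (t-positive fzero))
  ... | W , W-walk , (W-s , W-t) , W-len , fits =
    realises-cong (λ _ → refl) (λ _ → refl) (+-monoˡ-≤ 1 (m≤n⊔m _ _))
      (realises-++ (W , W-walk , W-s , W-t , W-len) (s-step i (proj₁ (endVertex-bounds W 1≤x x≤n W-walk)) fits))

  t-task : ∀ j {x} → 1 ≤ x → x ≤ n → Realises x (λ _ → 0) (indicator j) (M + 1)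
  t-task j {x} 1≤x x≤n
    with ascend (t (fsuc j)) s₀+tⱼ≤n K 1≤x x≤n (<-≤-trans (m<n+m _ 1≤x) (+-monoʳ-≤ x tⱼ≤K*s₀))
    where
    K : ℕ
    K = ceilDiv tₘₐₓ s₀
    tⱼ≤tₘₐₓ : t (fsuc j) ≤ tₘₐₓ
    tⱼ≤tₘₐₓ = increasing⇒≤last t-increasing (fsuc j)
    s₀+tⱼ≤n : s₀ + t (fsuc j) ≤ n
    s₀+tⱼ≤n = ≤-trans (+-monoʳ-≤ s₀ tⱼ≤tₘₐₓ) s₀+tₘₐₓ≤n
    tⱼ≤K*s₀ : t (fsuc j) ≤ K * s₀
    tⱼ≤K*s₀ = ≤-trans tⱼ≤tₘₐₓ (ceilDiv-spec tₘₐₓ s₀ (s-positive fzero))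
  ... | W , W-walk , (W-s , W-t) , W-len , tⱼ<end =
    realises-cong (λ _ → refl) (λ _ → refl) (+-monoˡ-≤ 1 (m≤m⊔n _ _))
      (realises-++ (W , W-walk , W-s , W-t , W-len) (t-step j tⱼ<end (proj₂ (endVertex-bounds W 1≤x x≤n W-walk))))

  realise : ∀ N {x} → 1 ≤ x → x ≤ n → (f : Fin p → ℕ) (g : Fin q → ℕ) → sumFin f + sumFin g ≡ N →
            Realises x f g (N * (M + 1))
  realise zero _ _ f g total≡0 =
    [] , tt ,
    (λ i → sym (sumFin≡0⇒≡0 f (m+n≡0⇒m≡0 _ total≡0) i)) ,
    (λ j → sym (sumFin≡0⇒≡0 g (m+n≡0⇒n≡0 _ total≡0) j)) , z≤n
  realise (suc N) 1≤x x≤n f g total with positiveEntry⊎allZero f | positiveEntry⊎allZero g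
  ... | inj₁ (i , _ , fᵢ) | _ =
    realises-cong (indicator+updateAt-pred f fᵢ) (λ _ → refl) ≤-refl
      (realises-then 1≤x x≤n (s-task i 1≤x x≤n) λ 1≤y y≤n →
        realise N 1≤y y≤n (updateAt f i pred) g (suc-injective (begin
          suc (sumFin (updateAt f i pred) + sumFin g) ≡⟨ cong (_+ sumFin g) (sumFin-updateAt-pred f i fᵢ) ⟨
          sumFin f + sumFin g                         ≡⟨ total ⟩
          suc N                                       ∎)))
    where open ≡-Reasoning
  ... | inj₂ _ | inj₁ (j , _ , gⱼ) =
    realises-cong (λ _ → refl) (indicator+updateAt-pred g gⱼ) ≤-refl
      (realises-then 1≤x x≤n (t-task j 1≤x x≤n) λ 1≤y y≤n →
        realise N 1≤y y≤n f (updateAt g j pred) (suc-injective (begin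
          suc (sumFin f + sumFin (updateAt g j pred)) ≡⟨ +-suc (sumFin f) _ ⟨
          sumFin f + suc (sumFin (updateAt g j pred)) ≡⟨ cong (sumFin f +_) (sumFin-updateAt-pred g j gⱼ) ⟨
          sumFin f + sumFin g                         ≡⟨ total ⟩
          suc N                                       ∎)))
    where open ≡-Reasoning
  ... | inj₂ f≡0 | inj₂ g≡0 =
    ⊥-elim (0≢1+n (trans (sym (cong₂ _+_ (sumFin-zero f≡0) (sumFin-zero g≡0))) total))

  Completion : ℕ → ℕ → ℕ → Set
  Completion x α β = Σ (List ℕ) λ W → IsWalk n s t x W ×
                     countS s₀ x W ≡ α × countT t₀ x W ≡ β × Neutral x W

  completion-up : ∀ {x α β} → 1 ≤ x → x + s₀ ≤ n → Completion (x + s₀) α β → Completion x (suc α) β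
  completion-up {x} 1≤x fits (W , W-walk , W-α , W-β , W-neutral) =
    x + s₀ ∷ W , (s-arc fzero 1≤x fits , W-walk) ,
    trans (countS-hit {u = x} W refl) (cong suc W-α) ,
    trans (countT-ascending t₀ x W (s-positive fzero)) W-β , neutral-up x W W-neutral

  completion-down : ∀ {y α β} → 1 ≤ y → y + t₀ ≤ n → Completion y α β → Completion (y + t₀) α (suc β)
  completion-down {y} 1≤y fits (W , W-walk , W-α , W-β , W-neutral) =
    y ∷ W , (t-arc fzero 1≤y fits , W-walk) ,
    trans (countS-descending s₀ y W (t-positive fzero)) W-α ,
    trans (countT-hit {w = y} W refl) (cong suc W-β) , neutral-down y W W-neutral

  -- Greedy: an s₀-arc whenever it stays inside [n], otherwise a t₀-arc; the
  -- equation keeps the prescribed final vertex u fixed.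
  complete : ∀ α β {x u} → 1 ≤ x → x ≤ n → 1 ≤ u → u ≤ n →
             x + α * s₀ ≡ u + β * t₀ → Completion x α β
  complete zero zero {x} _ _ _ _ _ = [] , tt , refl , refl , neutral-[] x
  complete zero (suc β) {x} {u} 1≤x x≤n 1≤u u≤n balanced with split-above {t₀} {x} t₀<x
    where
    t₀<x : t₀ < x
    t₀<x = begin-strict
      t₀                <⟨ m<n+m t₀ 1≤u ⟩
      u + t₀            ≤⟨ +-monoʳ-≤ u (m≤m+n t₀ (β * t₀)) ⟩
      u + (t₀ + β * t₀) ≡⟨ balanced ⟨
      x + 0             ≡⟨ +-identityʳ x ⟩
      x                 ∎
      where open ≤-Reasoning
  ... | y , 1≤y , refl =
    completion-down 1≤y x≤n (complete zero β 1≤y (≤-trans (m≤m+n y t₀) x≤n) 1≤u u≤n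
      (cancel-middle-≡ y t₀ 0 u (β * t₀) balanced))
  complete (suc α) β {x} 1≤x x≤n 1≤u u≤n balanced with x + s₀ ≤? n
  ... | yes fits =
    completion-up 1≤x fits (complete α β (≤-trans 1≤x (m≤m+n x s₀)) fits 1≤u u≤n
      (trans (+-assoc x s₀ (α * s₀)) balanced))
  complete (suc α) zero {x} {u} 1≤x x≤n 1≤u u≤n balanced | no ¬fits = ⊥-elim (¬fits (begin
    x + s₀            ≤⟨ +-monoʳ-≤ x (m≤m+n s₀ (α * s₀)) ⟩
    x + (s₀ + α * s₀) ≡⟨ balanced ⟩
    u + 0             ≡⟨ +-identityʳ u ⟩
    u                 ≤⟨ u≤n ⟩
    n                 ∎))
    where open ≤-Reasoning
  complete (suc α) (suc β) {x} {u} 1≤x x≤n 1≤u u≤n balanced | no ¬fits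
    with split-above {t₀} {x} (overflow⇒< t₀+s₀≤n (≰⇒> ¬fits))
  ... | y , 1≤y , refl =
    completion-down 1≤y x≤n (complete (suc α) β 1≤y (≤-trans (m≤m+n y t₀) x≤n) 1≤u u≤n
      (cancel-middle-≡ y t₀ (suc α * s₀) u (β * t₀) balanced))

  extend : ∀ {v} → 1 ≤ v → v ≤ n → (as : Fin p → ℕ) (bs : Fin q → ℕ) (W : List ℕ) → IsWalk n s t v W →
           (∀ i → countS (s (fsuc i)) v W ≡ as i) → (∀ j → countT (t (fsuc j)) v W ≡ bs j) →
           ∀ {a b u} → countS s₀ v W ≤ a → countT t₀ v W ≤ b → 1 ≤ u → u ≤ n →
           u + (b * t₀ + sumFin (λ j → bs j * t (fsuc j))) ≡ v + a * s₀ + sumFin (λ i → as i * s (fsuc i)) →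
           Σ (List ℕ) λ W′ → IsWalk n s t v W′ × countS s₀ v W′ ≡ a × countT t₀ v W′ ≡ b ×
             (∀ i → countS (s (fsuc i)) v W′ ≡ as i) × (∀ j → countT (t (fsuc j)) v W′ ≡ bs j)
  extend {v} 1≤v v≤n as bs W W-walk W-s W-t {u = u} a₁≤a b₁≤b 1≤u u≤n target
    with m≤n⇒∃[o]m+o≡n a₁≤a | m≤n⇒∃[o]m+o≡n b₁≤b
  ... | α , refl | β , refl
    with complete α β (proj₁ end-bounds) (proj₂ end-bounds) 1≤u u≤n
           (residual-balance (endVertex v W) u v (countS s₀ v W) α (countT t₀ v W) β s₀ t₀ A B balance target)
    where
    end-bounds : 1 ≤ endVertex v W × endVertex v W ≤ n
    end-bounds = endVertex-bounds W 1≤v v≤n W-walk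
    A B : ℕ
    A = sumFin (λ i → as i * s (fsuc i))
    B = sumFin (λ j → bs j * t (fsuc j))
    balance : endVertex v W + (countT t₀ v W * t₀ + B) ≡ v + (countS s₀ v W * s₀ + A)
    balance = subst₂ (λ B A → endVertex v W + (countT t₀ v W * t₀ + B) ≡ v + (countS s₀ v W * s₀ + A))
                (sumFin-cong λ j → cong (_* t (fsuc j)) (W-t j)) (sumFin-cong λ i → cong (_* s (fsuc i)) (W-s i))
                (endVertex-balance v W W-walk)
  ... | X , X-walk , X-α , X-β , (X-s , X-t) =
    W ++ X , IsWalk-++ W W-walk X-walk ,
    trans (countS-++ s₀ v W X) (cong (countS s₀ v W +_) X-α) ,
    trans (countT-++ t₀ v W X) (cong (countT t₀ v W +_) X-β) ,
    (λ i → trans (countS-++ _ v W X) (trans (cong₂ _+_ (W-s i) (X-s i)) (+-identityʳ (as i)))) ,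
    (λ j → trans (countT-++ _ v W X) (trans (cong₂ _+_ (W-t j) (X-t j)) (+-identityʳ (bs j))))

-- Opened only here: the prefix + of ℤ makes sections such as (x +_) ambiguous.
open import Data.Integer using (+_; _-_) renaming (_≤_ to _≤ℤ_)

theorem3p3 : (n p q : ℕ) → 2 ≤ n →
    (s : Fin (suc p) → ℕ) → (t : Fin (suc q) → ℕ) →
    (∀ i → 1 ≤ s i × s i + 1 ≤ n) → (∀ j → 1 ≤ t j × t j + 1 ≤ n) →
    (∀ i i′ → i <ᶠ i′ → s i < s i′) → (∀ j j′ → j <ᶠ j′ → t j < t j′) →
    s (fromℕ p) + t fzero ≤ n → s fzero + t (fromℕ q) ≤ n →
    (v : ℕ) → 1 ≤ v → v ≤ n →
    (as : Fin p → ℕ) → (bs : Fin q → ℕ) →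
    (Σ (List ℕ) λ W →
       IsWalk n s t v W ×
       (∀ i → countS (s (fsuc i)) v W ≡ as i) ×
       (∀ j → countT (t (fsuc j)) v W ≡ bs j) ×
       length W ≤ (sumFin as + sumFin bs) *
                   ((ceilDiv (t (fromℕ q)) (s fzero) ⊔ ceilDiv (s (fromℕ p)) (t fzero)) + 1))
    ×
    ((W : List ℕ) → IsWalk n s t v W →
       (∀ i → countS (s (fsuc i)) v W ≡ as i) →
       (∀ j → countT (t (fsuc j)) v W ≡ bs j) →
       length W ≤ (sumFin as + sumFin bs) *
                   ((ceilDiv (t (fromℕ q)) (s fzero) ⊔ ceilDiv (s (fromℕ p)) (t fzero)) + 1) →
       (a b : ℕ) → countS (s fzero) v W ≤ a → countT (t fzero) v W ≤ b →
       + 1 ≤ℤ (+ (v + a * s fzero + sumFin (λ i → as i * s (fsuc i)))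
                - + (b * t fzero + sumFin (λ j → bs j * t (fsuc j)))) →
       (+ (v + a * s fzero + sumFin (λ i → as i * s (fsuc i)))
                - + (b * t fzero + sumFin (λ j → bs j * t (fsuc j)))) ≤ℤ + n →
       Σ (List ℕ) λ W′ →
         IsWalk n s t v W′ ×
         countS (s fzero) v W′ ≡ a × countT (t fzero) v W′ ≡ b ×
         (∀ i → countS (s (fsuc i)) v W′ ≡ as i) ×
         (∀ j → countT (t (fsuc j)) v W′ ≡ bs j))
theorem3p3 n p q _ s t s-bounds t-bounds s-increasing t-increasing sₘₐₓ+t₀≤n s₀+tₘₐₓ≤n
           v 1≤v v≤n as bs =
  realise (sumFin as + sumFin bs) 1≤v v≤n as bs refl ,
  λ W W-walk W-s W-t _ _ _ a₁≤a b₁≤b low high →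
    let (u , 1≤u , u≤n , target) = inRange-difference _ _ n low high
    in  extend 1≤v v≤n as bs W W-walk W-s W-t a₁≤a b₁≤b 1≤u u≤n target
  where
  open Construction n p q s t (proj₁ ∘ s-bounds) (proj₁ ∘ t-bounds) s-increasing t-increasing
                    sₘₐₓ+t₀≤n s₀+tₘₐₓ≤n
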